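{- Let $k\geq 2$, let $\lambda\vdash k$, and let $0\leq\alpha\leq k-2$. Then \[f_{2,\alpha}^{\lambda}+f_{2,\alpha}^{\lambda^{t}}=f^{\lambda}.\]
   Context: For a partition $\lambda\vdash k$, its diagram has boxes $(i,j)$, $1\le i\le\ell(\lambda)$, $1\le j\le\lambda_i$ (row $i$ from the top). $\operatorname{SYT}(\lambda)$ is the set of standard Young tableaux of shape $\lambda$ (bijective fillings of the boxes with $1,\ldots,k$ increasing along rows and down columns), and $f^\lambda=|\operatorname{SYT}(\lambda)|$. For $T\in\operatorname{SYT}(\lambda)$ and $1\le m\le k$, $R_T(m)$ denotes the row of the box containing $m$. For integers $0\le h\le k$ and $0\le\alpha\le k-h$, $\operatorname{SYT}_{h,\alpha}(\lambda)$ is the set of $T\in\operatorname{SYT}(\lambda)$ such that $R_T(i+1+\alpha)>R_T(i+\alpha)$ for all $1\le i<h$, and $f^{\lambda}_{h,\alpha}=|\operatorname{SYT}_{h,\alpha}(\lambda)|$. The transpose partition $\lambda^t$ is the partition whose diagram is obtained from that of $\lambda$ by reflecting across the main diagonal (its $j$-th part is the number of $i$ with $\lambda_i\ge j$). -}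

module Defs where

open import Data.Nat using (ℕ; zero; suc; _+_; _∸_; _<ᵇ_; _≡ᵇ_; _≤ᵇ_; _≤_; _≥_; _>_)
open import Data.Bool using (Bool; true; false; _∧_; _∨_; if_then_else_; not)
open import Data.List using (List; []; _∷_; map; concatMap; filter; length; upTo; concat; foldr)
open import Data.List.Relation.Unary.All using (All)
open import Data.Nat.ListAction using (sum)
open import Data.List.Relation.Unary.Linked using (Linked)
open import Data.Product using (_×_)
open import Relation.Binary.PropositionalEquality using (_≡_)
open import Relation.Nullary.Decidable using (⌊_⌋)

IsPartitionOf : List ℕ → ℕ → Set
IsPartitionOf λs k = Linked _≥_ λs × All (λ p → p > 0) λs × sum λs ≡ k

countGE : ℕ → List ℕ → ℕ
countGE j λs = length (filter (λ p → Data.Nat._≤?_ j p) λs)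

transpose : List ℕ → List ℕ
transpose [] = []
transpose (a ∷ as) = map (λ j → countGE (suc j) (a ∷ as)) (upTo a)

-- A filling of the diagram of λ with numbers from {1,…,k} is
-- represented row by row as a list of rows (row i from the top), row i
-- being the list of entries in boxes (i,1),(i,2),…,(i,λᵢ).

values : ℕ → List ℕ
values k = map suc (upTo k)

words : ℕ → ℕ → List (List ℕ)
words k zero = [] ∷ []
words k (suc n) = concatMap (λ v → map (v ∷_) (words k n)) (values k)

fillings : ℕ → List ℕ → List (List (List ℕ))
fillings k [] = [] ∷ []
fillings k (r ∷ rs) = concatMap (λ row → map (row ∷_) (fillings k rs)) (words k r)

occ : ℕ → List ℕ → ℕ
occ m xs = length (filter (λ x → Data.Nat._≟_ m x) xs)

allB : {A : Set} → (A → Bool) → List A → Bool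
allB p = foldr (λ x b → p x ∧ b) true

-- the filling is a bijection onto {1,…,k}: every m ∈ [1..k] occurs exactly once
-- (entries are in [1..k] by construction)
bijective : ℕ → List (List ℕ) → Bool
bijective k T = allB (λ m → occ m (concat T) ≡ᵇ 1) (values k)

increasing : List ℕ → Bool
increasing [] = true
increasing (x ∷ []) = true
increasing (x ∷ y ∷ xs) = (x <ᵇ y) ∧ increasing (y ∷ xs)

-- row `upper` directly above row `lower`: entries increase down columns
-- (the lower row is no longer than the upper one for partition shapes)
columnsBelow : List ℕ → List ℕ → Bool
columnsBelow (u ∷ us) (l ∷ ls) = (u <ᵇ l) ∧ columnsBelow us ls
columnsBelow _ _ = true

columnsIncreasing : List (List ℕ) → Bool
columnsIncreasing [] = true
columnsIncreasing (r ∷ []) = true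
columnsIncreasing (r ∷ r' ∷ rs) = columnsBelow r r' ∧ columnsIncreasing (r' ∷ rs)

isSYT : ℕ → List (List ℕ) → Bool
isSYT k T = bijective k T ∧ allB increasing T ∧ columnsIncreasing T

SYT : ℕ → List ℕ → List (List (List ℕ))
SYT k λs = filter (λ T → Data.Bool._≟_ (isSYT k T) true) (fillings k λs)

f : ℕ → List ℕ → ℕ
f k λs = length (SYT k λs)

R : List (List ℕ) → ℕ → ℕ
R [] m = 0
R (r ∷ rs) m = if occ m r ≡ᵇ 0 then suc (R rs m) else 1

condHα : ℕ → ℕ → List (List ℕ) → Bool
condHα h α T = allB (λ i → R T (i + α) <ᵇ R T (suc i + α)) (map suc (upTo (h ∸ 1)))

SYTHα : ℕ → ℕ → ℕ → List ℕ → List (List (List ℕ))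
SYTHα h α k λs = filter (λ T → Data.Bool._≟_ (condHα h α T) true) (SYT k λs)

fHα : ℕ → ℕ → ℕ → List ℕ → ℕ
fHα h α k λs = length (SYTHα h α k λs)

-- Transposition T ↦ Tᵗ is an involution carrying SYT(λ) onto SYT(λᵗ), and
-- R_{Tᵗ}(m) is the column of m in T.  In a standard tableau the entry a + 1
-- lies either in a lower row than a or in a later column than a, never both
-- and never neither.  With a = α + 1, transposition therefore matches the
-- tableaux of shape λ violating the condition of SYT_{2,α}(λ) with
-- SYT_{2,α}(λᵗ), so f^λ = f^λ_{2,α} + f^{λᵗ}_{2,α}.

module Submission where

open import Defs
open import Algebra.Bundles using (CommutativeMonoid)
open import Data.Bool using (Bool; true; false; _∧_; not; if_then_else_)
import Data.Bool
open import Data.Bool.Properties using (∧-comm; ∧-commutativeMonoid; ∧-identityʳ; not-involutive; T-≡; ¬-not)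
open import Data.Empty using (⊥-elim)
open import Data.List using (List; []; _∷_; map; concatMap; filter; length; concat; _++_; applyUpTo; replicate; cartesianProductWith)
open import Data.List.Membership.Propositional using (_∈_)
open import Data.List.Membership.Propositional.Properties using (∈-filter⁺; ∈-filter⁻; ∈-map⁺; ∈-upTo⁺; ∈-cartesianProductWith⁻; ∈-cartesianProductWith⁺)
open import Data.List.Properties using (∷-injective; length-++; length-replicate; filter-++; filter-accept; filter-reject; filter-none; map-upTo; ≡-dec)
open import Data.List.Relation.Unary.All using (All; []; _∷_)
import Data.List.Relation.Unary.All as All
import Data.List.Relation.Unary.All.Properties as All
open import Data.List.Relation.Unary.AllPairs using ([]; _∷_)
open import Data.List.Relation.Unary.Any using (here; there)
open import Data.List.Relation.Unary.Linked using (Linked; []; [-]; _∷_)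
open import Data.List.Relation.Unary.Linked.Properties using (Linked⇒All)
open import Data.List.Relation.Unary.Unique.Propositional using (Unique)
import Data.List.Relation.Unary.Unique.Propositional.Properties as Unique
open import Data.Nat using (ℕ; zero; suc; _+_; _∸_; _≤_; _<_; _≥_; _>_; _<ᵇ_; _≡ᵇ_; z≤n; s≤s)
open import Data.Nat.Properties
open import Data.Product using (_×_; _,_; Σ; proj₁; proj₂)
open import Data.Sum using (_⊎_; inj₁; inj₂)
open import Function using (_∘_)
open import Function.Bundles using (Equivalence)
open import Relation.Binary.Definitions using (DecidableEquality; tri<; tri≈; tri>)
open import Relation.Binary.PropositionalEquality using (_≡_; _≢_; refl; sym; trans; cong; cong₂; subst; module ≡-Reasoning)
open import Relation.Nullary using (yes; no)

open import Algebra.Properties.CommutativeSemigroup (CommutativeMonoid.commutativeSemigroup ∧-commutativeMonoid)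
  using () renaming (interchange to ∧-interchange)
open import Algebra.Properties.CommutativeSemigroup +-commutativeSemigroup
  using () renaming (interchange to +-interchange)

∧-true⁻ : ∀ {a b} → a ∧ b ≡ true → a ≡ true × b ≡ true
∧-true⁻ {true} {true} _ = refl , refl

<⇒<ᵇ≡true : ∀ {m n} → m < n → (m <ᵇ n) ≡ true
<⇒<ᵇ≡true = Equivalence.to T-≡ ∘ <⇒<ᵇ

≥⇒<ᵇ≡false : ∀ {m n} → n ≤ m → (m <ᵇ n) ≡ false
≥⇒<ᵇ≡false {m} {n} n≤m = ¬-not (λ m<ᵇn → ≤⇒≯ n≤m (<ᵇ⇒< m n (Equivalence.from T-≡ m<ᵇn)))

<ᵇ≡true⇒< : ∀ {m n} → (m <ᵇ n) ≡ true → m < n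
<ᵇ≡true⇒< {m} {n} = <ᵇ⇒< m n ∘ Equivalence.from T-≡

allB-∈ : ∀ {A : Set} (p : A → Bool) {x xs} → allB p xs ≡ true → x ∈ xs → p x ≡ true
allB-∈ p {xs = y ∷ ys} h (here refl) = proj₁ (∧-true⁻ {p y} h)
allB-∈ p {xs = y ∷ ys} h (there x∈ys) = allB-∈ p (proj₂ (∧-true⁻ {p y} h)) x∈ys

allB-cong : ∀ {A : Set} (p q : A → Bool) xs → (∀ x → p x ≡ q x) → allB p xs ≡ allB q xs
allB-cong p q [] _ = refl
allB-cong p q (x ∷ xs) p≗q = cong₂ _∧_ (p≗q x) (allB-cong p q xs p≗q)

length-filter-true+false : ∀ {A : Set} (c : A → Bool) xs →
  length (filter (λ x → Data.Bool._≟_ (c x) true) xs) + length (filter (λ x → Data.Bool._≟_ (c x) false) xs)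
    ≡ length xs
length-filter-true+false c [] = refl
length-filter-true+false c (x ∷ xs) with c x
... | true = cong suc (length-filter-true+false c xs)
... | false = trans (+-suc _ _) (cong suc (length-filter-true+false c xs))

module _ {B : Set} (_≟B_ : DecidableEquality B) where

  remove : B → List B → List B
  remove b [] = []
  remove b (y ∷ ys) with b ≟B y
  ... | yes _ = ys
  ... | no _ = y ∷ remove b ys

  length-remove : ∀ {b ys} → b ∈ ys → length ys ≡ suc (length (remove b ys))
  length-remove {b} {y ∷ ys} (here refl) with b ≟B b
  ... | yes _ = refl
  ... | no b≢b = ⊥-elim (b≢b refl)
  length-remove {b} {y ∷ ys} (there b∈ys) with b ≟B y
  ... | yes _ = refl
  ... | no _ = cong suc (length-remove b∈ys)

  ∈-remove : ∀ {b c ys} → c ∈ ys → c ≢ b → c ∈ remove b ys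
  ∈-remove {b} {c} {y ∷ ys} (here refl) c≢b with b ≟B y
  ... | yes b≡c = ⊥-elim (c≢b (sym b≡c))
  ... | no _ = here refl
  ∈-remove {b} {c} {y ∷ ys} (there c∈ys) c≢b with b ≟B y
  ... | yes _ = c∈ys
  ... | no _ = there (∈-remove c∈ys c≢b)

  length-≤-by-injection : ∀ {A : Set} (g : A → B) (xs : List A) (ys : List B) → Unique xs →
    (∀ {x} → x ∈ xs → g x ∈ ys) → (∀ {x y} → x ∈ xs → y ∈ xs → g x ≡ g y → x ≡ y) →
    length xs ≤ length ys
  length-≤-by-injection g [] ys _ _ _ = z≤n
  length-≤-by-injection g (x ∷ xs) ys (x∉xs ∷ unique) maps injective =
    subst (suc (length xs) ≤_) (sym (length-remove (maps (here refl))))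
      (s≤s (length-≤-by-injection g xs (remove (g x) ys) unique
        (λ y∈xs → ∈-remove (maps (there y∈xs))
          (λ gy≡gx → All.lookup x∉xs y∈xs (injective (here refl) (there y∈xs) (sym gy≡gx))))
        (λ p q → injective (there p) (there q))))

-- Shapes and the transpose of a filling

data IsShape : List ℕ → Set where
  []   : IsShape []
  cons : ∀ {n ns} → 0 < n → All (_≤ n) ns → IsShape ns → IsShape (n ∷ ns)

IsPartitionOf⇒IsShape : ∀ {μ k} → IsPartitionOf μ k → IsShape μ
IsPartitionOf⇒IsShape (decreasing , positive , _) = go decreasing positive
  where
    go : ∀ {μ} → Linked _≥_ μ → All (_> 0) μ → IsShape μ
    go [] [] = []
    go [-] (p ∷ []) = cons p [] []
    go (n≥m ∷ linked) (p ∷ ps) = cons p (Linked⇒All (λ a b → ≤-trans b a) n≥m linked) (go linked ps)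

shape : List (List ℕ) → List ℕ
shape = map length

IsShape-tail : ∀ {n ns} → IsShape (n ∷ ns) → IsShape ns
IsShape-tail (cons _ _ s) = s

consColumn : List ℕ → List (List ℕ) → List (List ℕ)
consColumn [] C = C
consColumn (x ∷ xs) [] = (x ∷ []) ∷ consColumn xs []
consColumn (x ∷ xs) (c ∷ C) = (x ∷ c) ∷ consColumn xs C

infix 10 _ᵗ

_ᵗ : List (List ℕ) → List (List ℕ)
[] ᵗ = []
(r ∷ rs) ᵗ = consColumn r (rs ᵗ)

length-consColumn-≤ : ∀ {n} r C → length r ≤ n → length C ≤ n → length (consColumn r C) ≤ n
length-consColumn-≤ [] C _ C≤n = C≤n
length-consColumn-≤ (x ∷ xs) [] (s≤s xs≤n) _ = s≤s (length-consColumn-≤ xs [] xs≤n z≤n)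
length-consColumn-≤ (x ∷ xs) (c ∷ C) (s≤s xs≤n) (s≤s C≤n) = s≤s (length-consColumn-≤ xs C xs≤n C≤n)

length-ᵗ-≤ : ∀ {n} T → All (λ r → length r ≤ n) T → length (T ᵗ) ≤ n
length-ᵗ-≤ [] [] = z≤n
length-ᵗ-≤ (r ∷ rs) (r≤n ∷ rs≤n) = length-consColumn-≤ r (rs ᵗ) r≤n (length-ᵗ-≤ rs rs≤n)

length-ᵗ-≤-head : ∀ r rs → IsShape (shape (r ∷ rs)) → length (rs ᵗ) ≤ length r
length-ᵗ-≤-head r rs (cons _ rs≤r _) = length-ᵗ-≤ rs (All.map⁻ rs≤r)

ᵗ-consColumn : ∀ x xs C → length C ≤ suc (length xs) → (consColumn (x ∷ xs) C) ᵗ ≡ (x ∷ xs) ∷ C ᵗ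
ᵗ-consColumn x [] [] _ = refl
ᵗ-consColumn x [] (c ∷ []) _ = refl
ᵗ-consColumn x [] (c ∷ d ∷ C) (s≤s ())
ᵗ-consColumn x (y ∷ xs) [] _ = cong (consColumn (x ∷ [])) (ᵗ-consColumn y xs [] z≤n)
ᵗ-consColumn x (y ∷ xs) (c ∷ C) (s≤s C≤xs) = cong (consColumn (x ∷ c)) (ᵗ-consColumn y xs C C≤xs)

ᵗ-involutive : ∀ T → IsShape (shape T) → T ᵗ ᵗ ≡ T
ᵗ-involutive [] _ = refl
ᵗ-involutive ([] ∷ rs) (cons () _ _)
ᵗ-involutive ((x ∷ xs) ∷ rs) s = begin
  consColumn (x ∷ xs) (rs ᵗ) ᵗ ≡⟨ ᵗ-consColumn x xs (rs ᵗ) (length-ᵗ-≤-head (x ∷ xs) rs s) ⟩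
  (x ∷ xs) ∷ rs ᵗ ᵗ            ≡⟨ cong ((x ∷ xs) ∷_) (ᵗ-involutive rs (IsShape-tail s)) ⟩
  (x ∷ xs) ∷ rs                ∎
  where open ≡-Reasoning

shape-consColumn-≤ : ∀ {n} r C → All (_≤ n) (shape C) → All (_≤ suc n) (shape (consColumn r C))
shape-consColumn-≤ [] [] [] = []
shape-consColumn-≤ [] (c ∷ C) (c≤n ∷ C≤n) = m≤n⇒m≤1+n c≤n ∷ shape-consColumn-≤ [] C C≤n
shape-consColumn-≤ (x ∷ xs) [] [] = s≤s z≤n ∷ shape-consColumn-≤ xs [] []
shape-consColumn-≤ (x ∷ xs) (c ∷ C) (c≤n ∷ C≤n) = s≤s c≤n ∷ shape-consColumn-≤ xs C C≤n

IsShape-consColumn : ∀ r C → IsShape (shape C) → length C ≤ length r → IsShape (shape (consColumn r C))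
IsShape-consColumn [] [] s _ = s
IsShape-consColumn (x ∷ xs) [] _ _ =
  cons (s≤s z≤n) (shape-consColumn-≤ xs [] []) (IsShape-consColumn xs [] [] z≤n)
IsShape-consColumn (x ∷ xs) (c ∷ C) (cons _ C≤c s) (s≤s C≤xs) =
  cons (s≤s z≤n) (shape-consColumn-≤ xs C C≤c) (IsShape-consColumn xs C s C≤xs)

IsShape-ᵗ : ∀ T → IsShape (shape T) → IsShape (shape (T ᵗ))
IsShape-ᵗ [] s = s
IsShape-ᵗ (r ∷ rs) s =
  IsShape-consColumn r (rs ᵗ) (IsShape-ᵗ rs (IsShape-tail s)) (length-ᵗ-≤-head r rs s)

firstPart : List ℕ → ℕ
firstPart [] = 0
firstPart (n ∷ _) = n

applyUpTo-cong : ∀ {A : Set} (g h : ℕ → A) n → (∀ j → j < n → g j ≡ h j) → applyUpTo g n ≡ applyUpTo h n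
applyUpTo-cong g h zero _ = refl
applyUpTo-cong g h (suc n) g≗h =
  cong₂ _∷_ (g≗h 0 (s≤s z≤n)) (applyUpTo-cong (g ∘ suc) (h ∘ suc) n (λ j j<n → g≗h (suc j) (s≤s j<n)))

transpose≡applyUpTo : ∀ μ → transpose μ ≡ applyUpTo (λ j → countGE (suc j) μ) (firstPart μ)
transpose≡applyUpTo [] = refl
transpose≡applyUpTo (n ∷ ns) = map-upTo (λ j → countGE (suc j) (n ∷ ns)) n

countGE-∷-≤ : ∀ j n ns → suc j ≤ n → countGE (suc j) (n ∷ ns) ≡ suc (countGE (suc j) ns)
countGE-∷-≤ j n ns j<n = cong length (filter-accept (suc j ≤?_) {n} {ns} j<n)

countGE-≥-bound : ∀ j b ns → All (_≤ b) ns → b ≤ j → countGE (suc j) ns ≡ 0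
countGE-≥-bound j b ns ns≤b b≤j =
  cong length (filter-none (suc j ≤?_) (All.map (λ n≤b j<n → <⇒≱ (s≤s (≤-trans n≤b b≤j)) j<n) ns≤b))

IsShape⇒All-≤-firstPart : ∀ {ns} → IsShape ns → All (_≤ firstPart ns) ns
IsShape⇒All-≤-firstPart [] = []
IsShape⇒All-≤-firstPart (cons _ ns≤n _) = ≤-refl ∷ ns≤n

firstPart-tail-≤ : ∀ {n ns} → IsShape (n ∷ ns) → firstPart ns ≤ n
firstPart-tail-≤ (cons _ [] _) = z≤n
firstPart-tail-≤ (cons _ (m≤n ∷ _) _) = m≤n

shape-consColumn : ∀ r C (g : ℕ → ℕ) n → shape C ≡ applyUpTo g n → n ≤ length r → (∀ j → n ≤ j → g j ≡ 0) →
  shape (consColumn r C) ≡ applyUpTo (suc ∘ g) (length r)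
shape-consColumn [] [] g zero _ _ _ = refl
shape-consColumn (x ∷ xs) [] g zero _ _ g≡0 =
  cong₂ _∷_ (cong suc (sym (g≡0 0 z≤n))) (shape-consColumn xs [] (g ∘ suc) zero refl z≤n (λ j _ → g≡0 (suc j) z≤n))
shape-consColumn (x ∷ xs) (c ∷ C) g (suc n) eq (s≤s n≤xs) g≡0 =
  cong₂ _∷_ (cong suc (proj₁ (∷-injective eq)))
    (shape-consColumn xs C (g ∘ suc) n (proj₂ (∷-injective eq)) n≤xs (λ j n≤j → g≡0 (suc j) (s≤s n≤j)))

shape-ᵗ : ∀ T → IsShape (shape T) → shape (T ᵗ) ≡ transpose (shape T)
shape-ᵗ [] _ = refl
shape-ᵗ (r ∷ rs) s@(cons _ _ s′) = begin
  shape (consColumn r (rs ᵗ))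
    ≡⟨ shape-consColumn r (rs ᵗ) g (firstPart (shape rs))
         (trans (shape-ᵗ rs s′) (transpose≡applyUpTo (shape rs))) (firstPart-tail-≤ s)
         (λ j → countGE-≥-bound j (firstPart (shape rs)) (shape rs) (IsShape⇒All-≤-firstPart s′)) ⟩
  applyUpTo (suc ∘ g) (length r)
    ≡⟨ applyUpTo-cong _ _ (length r) (λ j j<r → sym (countGE-∷-≤ j (length r) (shape rs) j<r)) ⟩
  applyUpTo (λ j → countGE (suc j) (shape (r ∷ rs))) (length r)
    ≡⟨ transpose≡applyUpTo (shape (r ∷ rs)) ⟨
  transpose (shape (r ∷ rs)) ∎
  where
    open ≡-Reasoning
    g : ℕ → ℕ
    g j = countGE (suc j) (shape rs)

-- A partition is the shape of the filling by zeros, which transfers the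
-- properties of ᵗ to transpose.
zeroFilling : List ℕ → List (List ℕ)
zeroFilling = map (λ n → replicate n 0)

shape-zeroFilling : ∀ μ → shape (zeroFilling μ) ≡ μ
shape-zeroFilling [] = refl
shape-zeroFilling (n ∷ ns) = cong₂ _∷_ (length-replicate n) (shape-zeroFilling ns)

IsShape-transpose : ∀ {μ} → IsShape μ → IsShape (transpose μ)
IsShape-transpose {μ} s =
  subst IsShape (trans (shape-ᵗ Z s′) (cong transpose (shape-zeroFilling μ))) (IsShape-ᵗ Z s′)
  where
    Z = zeroFilling μ
    s′ = subst IsShape (sym (shape-zeroFilling μ)) s

transpose-involutive : ∀ {μ} → IsShape μ → transpose (transpose μ) ≡ μ
transpose-involutive {μ} s = begin
  transpose (transpose μ)               ≡⟨ cong (transpose ∘ transpose) (shape-zeroFilling μ) ⟨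
  transpose (transpose (shape Z))       ≡⟨ cong transpose (shape-ᵗ Z s′) ⟨
  transpose (shape (Z ᵗ))               ≡⟨ shape-ᵗ (Z ᵗ) (IsShape-ᵗ Z s′) ⟨
  shape (Z ᵗ ᵗ)                         ≡⟨ cong shape (ᵗ-involutive Z s′) ⟩
  shape Z                               ≡⟨ shape-zeroFilling μ ⟩
  μ                                     ∎
  where
    open ≡-Reasoning
    Z = zeroFilling μ
    s′ = subst IsShape (sym (shape-zeroFilling μ)) s

-- Enumerating fillings

conses≡cartesianProduct : ∀ {A : Set} (W : List (List A)) vs →
  concatMap (λ v → map (v ∷_) W) vs ≡ cartesianProductWith _∷_ vs W
conses≡cartesianProduct W [] = refl
conses≡cartesianProduct W (v ∷ vs) = cong (map (v ∷_) W ++_) (conses≡cartesianProduct W vs)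

∈-conses⁻ : ∀ {A : Set} (W : List (List A)) vs {u} → u ∈ concatMap (λ v → map (v ∷_) W) vs →
  Σ A λ v → Σ (List A) λ w → v ∈ vs × w ∈ W × u ≡ v ∷ w
∈-conses⁻ W vs u∈ = ∈-cartesianProductWith⁻ _∷_ vs W (subst (_ ∈_) (conses≡cartesianProduct W vs) u∈)

∈-conses⁺ : ∀ {A : Set} (W : List (List A)) vs {v w} → v ∈ vs → w ∈ W → v ∷ w ∈ concatMap (λ v → map (v ∷_) W) vs
∈-conses⁺ W vs v∈ w∈ = subst (_ ∈_) (sym (conses≡cartesianProduct W vs)) (∈-cartesianProductWith⁺ _∷_ v∈ w∈)

conses-Unique : ∀ {A : Set} (W : List (List A)) vs → Unique vs → Unique W →
  Unique (concatMap (λ v → map (v ∷_) W) vs)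
conses-Unique W vs uvs uW =
  subst Unique (sym (conses≡cartesianProduct W vs)) (Unique.cartesianProductWith⁺ _∷_ ∷-injective uvs uW)

words-Unique : ∀ k n → Unique (words k n)
words-Unique k zero = [] ∷ []
words-Unique k (suc n) =
  conses-Unique (words k n) (values k) (Unique.map⁺ suc-injective (Unique.upTo⁺ k)) (words-Unique k n)

fillings-Unique : ∀ k μ → Unique (fillings k μ)
fillings-Unique k [] = [] ∷ []
fillings-Unique k (r ∷ rs) = conses-Unique (fillings k rs) (words k r) (words-Unique k r) (fillings-Unique k rs)

∈-words⁻ : ∀ k n {w} → w ∈ words k n → length w ≡ n × All (_∈ values k) w
∈-words⁻ k zero (here refl) = refl , []
∈-words⁻ k (suc n) w∈ with ∈-conses⁻ (words k n) (values k) w∈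
... | v , w , v∈ , w′∈ , refl with ∈-words⁻ k n w′∈
...   | length-w , w-values = cong suc length-w , v∈ ∷ w-values

∈-words⁺ : ∀ k n {w} → length w ≡ n → All (_∈ values k) w → w ∈ words k n
∈-words⁺ k zero {[]} _ _ = here refl
∈-words⁺ k (suc n) {v ∷ w} length-w (v∈ ∷ w-values) =
  ∈-conses⁺ (words k n) (values k) v∈ (∈-words⁺ k n (suc-injective length-w) w-values)

∈-fillings⁻ : ∀ k μ {T} → T ∈ fillings k μ → shape T ≡ μ × All (All (_∈ values k)) T
∈-fillings⁻ k [] (here refl) = refl , []
∈-fillings⁻ k (r ∷ rs) T∈ with ∈-conses⁻ (fillings k rs) (words k r) T∈
... | w , T′ , w∈ , T′∈ , refl with ∈-words⁻ k r w∈ | ∈-fillings⁻ k rs T′∈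
...   | length-w , w-values | shape-T′ , T′-values = cong₂ _∷_ length-w shape-T′ , w-values ∷ T′-values

∈-fillings⁺ : ∀ k μ {T} → shape T ≡ μ → All (All (_∈ values k)) T → T ∈ fillings k μ
∈-fillings⁺ k [] {[]} _ _ = here refl
∈-fillings⁺ k (r ∷ rs) {w ∷ T} shape-T (w-values ∷ T-values) =
  ∈-conses⁺ (fillings k rs) (words k r)
    (∈-words⁺ k r (proj₁ (∷-injective shape-T)) w-values)
    (∈-fillings⁺ k rs (proj₂ (∷-injective shape-T)) T-values)

-- Transposition preserves standardness

occ-here : ∀ m xs → occ m (m ∷ xs) ≡ suc (occ m xs)
occ-here m xs = cong length (filter-accept (m ≟_) {m} {xs} refl)

occ-there : ∀ m x xs → m ≢ x → occ m (x ∷ xs) ≡ occ m xs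
occ-there m x xs m≢x = cong length (filter-reject (m ≟_) {x} {xs} m≢x)

occ-++ : ∀ m xs ys → occ m (xs ++ ys) ≡ occ m xs + occ m ys
occ-++ m xs ys = trans (cong length (filter-++ (m ≟_) xs ys)) (length-++ (filter (m ≟_) xs))

occ-consColumn : ∀ m r C → occ m (concat (consColumn r C)) ≡ occ m r + occ m (concat C)
occ-consColumn m [] C = refl
occ-consColumn m (x ∷ xs) [] = begin
  occ m ((x ∷ []) ++ concat (consColumn xs []))   ≡⟨ occ-++ m (x ∷ []) _ ⟩
  occ m (x ∷ []) + occ m (concat (consColumn xs [])) ≡⟨ cong (occ m (x ∷ []) +_) (occ-consColumn m xs []) ⟩
  occ m (x ∷ []) + (occ m xs + 0)                ≡⟨ +-assoc (occ m (x ∷ [])) (occ m xs) 0 ⟨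
  occ m (x ∷ []) + occ m xs + 0                  ≡⟨ cong (_+ 0) (occ-++ m (x ∷ []) xs) ⟨
  occ m (x ∷ xs) + 0                             ∎
  where open ≡-Reasoning
occ-consColumn m (x ∷ xs) (c ∷ C) = begin
  occ m ((x ∷ c) ++ concat (consColumn xs C))
    ≡⟨ occ-++ m (x ∷ c) _ ⟩
  occ m (x ∷ c) + occ m (concat (consColumn xs C))
    ≡⟨ cong₂ _+_ (occ-++ m (x ∷ []) c) (occ-consColumn m xs C) ⟩
  (occ m (x ∷ []) + occ m c) + (occ m xs + occ m (concat C))
    ≡⟨ +-interchange (occ m (x ∷ [])) (occ m c) (occ m xs) (occ m (concat C)) ⟩
  (occ m (x ∷ []) + occ m xs) + (occ m c + occ m (concat C))
    ≡⟨ cong₂ _+_ (occ-++ m (x ∷ []) xs) (occ-++ m c (concat C)) ⟨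
  occ m (x ∷ xs) + occ m (concat (c ∷ C)) ∎
  where open ≡-Reasoning

occ-ᵗ : ∀ m T → occ m (concat (T ᵗ)) ≡ occ m (concat T)
occ-ᵗ m [] = refl
occ-ᵗ m (r ∷ rs) = begin
  occ m (concat (consColumn r (rs ᵗ))) ≡⟨ occ-consColumn m r (rs ᵗ) ⟩
  occ m r + occ m (concat (rs ᵗ))      ≡⟨ cong (occ m r +_) (occ-ᵗ m rs) ⟩
  occ m r + occ m (concat rs)          ≡⟨ occ-++ m r (concat rs) ⟨
  occ m (concat (r ∷ rs))              ∎
  where open ≡-Reasoning

bijective-ᵗ : ∀ k T → bijective k (T ᵗ) ≡ bijective k T
bijective-ᵗ k T = allB-cong _ _ (values k) (λ m → cong (_≡ᵇ 1) (occ-ᵗ m T))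

All-consColumn : ∀ {P : ℕ → Set} r C → All P r → All (All P) C → All (All P) (consColumn r C)
All-consColumn [] C _ C-P = C-P
All-consColumn (x ∷ xs) [] (x-P ∷ xs-P) [] = (x-P ∷ []) ∷ All-consColumn xs [] xs-P []
All-consColumn (x ∷ xs) (c ∷ C) (x-P ∷ xs-P) (c-P ∷ C-P) = (x-P ∷ c-P) ∷ All-consColumn xs C xs-P C-P

All-ᵗ : ∀ {P : ℕ → Set} T → All (All P) T → All (All P) (T ᵗ)
All-ᵗ [] [] = []
All-ᵗ (r ∷ rs) (r-P ∷ rs-P) = All-consColumn r (rs ᵗ) r-P (All-ᵗ rs rs-P)

rowsIncreasing : List (List ℕ) → Bool
rowsIncreasing = allB increasing

rowsIncreasing-column : ∀ xs → rowsIncreasing (consColumn xs []) ≡ true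
rowsIncreasing-column [] = refl
rowsIncreasing-column (x ∷ xs) = rowsIncreasing-column xs

columnsBelow-[] : ∀ r → columnsBelow r [] ≡ true
columnsBelow-[] [] = refl
columnsBelow-[] (x ∷ r) = refl

rowsIncreasing-consColumn² : ∀ r r′ D → length D ≤ length r′ → length r′ ≤ length r →
  rowsIncreasing (consColumn r (consColumn r′ D)) ≡ columnsBelow r r′ ∧ rowsIncreasing (consColumn r′ D)
rowsIncreasing-consColumn² [] [] [] _ _ = refl
rowsIncreasing-consColumn² (x ∷ xs) [] [] _ _ = rowsIncreasing-column xs
rowsIncreasing-consColumn² (x ∷ xs) (y ∷ ys) [] _ (s≤s ys≤xs) =
  trans (cong (((x <ᵇ y) ∧ true) ∧_) (rowsIncreasing-consColumn² xs ys [] z≤n ys≤xs))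
    (∧-interchange (x <ᵇ y) true (columnsBelow xs ys) (rowsIncreasing (consColumn ys [])))
rowsIncreasing-consColumn² (x ∷ xs) (y ∷ ys) (d ∷ D) (s≤s D≤ys) (s≤s ys≤xs) =
  trans (cong (((x <ᵇ y) ∧ increasing (y ∷ d)) ∧_) (rowsIncreasing-consColumn² xs ys D D≤ys ys≤xs))
    (∧-interchange (x <ᵇ y) (increasing (y ∷ d)) (columnsBelow xs ys) (rowsIncreasing (consColumn ys D)))

rowsIncreasing-ᵗ : ∀ T → IsShape (shape T) → rowsIncreasing (T ᵗ) ≡ columnsIncreasing T
rowsIncreasing-ᵗ [] _ = refl
rowsIncreasing-ᵗ (r ∷ []) _ = rowsIncreasing-column r
rowsIncreasing-ᵗ (r ∷ r′ ∷ rs) (cons _ (r′≤r ∷ _) s′) =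
  trans (rowsIncreasing-consColumn² r r′ (rs ᵗ) (length-ᵗ-≤-head r′ rs s′) r′≤r)
    (cong (columnsBelow r r′ ∧_) (rowsIncreasing-ᵗ (r′ ∷ rs) s′))

columnsIncreasing-consColumn : ∀ r C → length C ≤ length r →
  columnsIncreasing (consColumn r C) ≡ increasing r ∧ columnsIncreasing C
columnsIncreasing-consColumn [] [] _ = refl
columnsIncreasing-consColumn (x ∷ []) [] _ = refl
columnsIncreasing-consColumn (x ∷ []) (c ∷ []) _ = refl
columnsIncreasing-consColumn (x ∷ []) (c ∷ d ∷ C) (s≤s ())
columnsIncreasing-consColumn (x ∷ y ∷ xs) [] _ =
  trans (cong (((x <ᵇ y) ∧ true) ∧_) (columnsIncreasing-consColumn (y ∷ xs) [] z≤n))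
    (∧-interchange (x <ᵇ y) true (increasing (y ∷ xs)) true)
columnsIncreasing-consColumn (x ∷ y ∷ xs) (c ∷ []) _ =
  trans (cong (λ b → ((x <ᵇ y) ∧ b) ∧ columnsIncreasing ((y ∷ []) ∷ consColumn xs [])) (columnsBelow-[] c))
    (trans (cong (((x <ᵇ y) ∧ true) ∧_) (columnsIncreasing-consColumn (y ∷ xs) [] z≤n))
      (∧-interchange (x <ᵇ y) true (increasing (y ∷ xs)) true))
columnsIncreasing-consColumn (x ∷ y ∷ xs) (c ∷ d ∷ C) (s≤s C≤xs) =
  trans (cong (((x <ᵇ y) ∧ columnsBelow c d) ∧_) (columnsIncreasing-consColumn (y ∷ xs) (d ∷ C) C≤xs))
    (∧-interchange (x <ᵇ y) (columnsBelow c d) (increasing (y ∷ xs)) (columnsIncreasing (d ∷ C)))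

columnsIncreasing-ᵗ : ∀ T → IsShape (shape T) → columnsIncreasing (T ᵗ) ≡ rowsIncreasing T
columnsIncreasing-ᵗ [] _ = refl
columnsIncreasing-ᵗ (r ∷ rs) s =
  trans (columnsIncreasing-consColumn r (rs ᵗ) (length-ᵗ-≤-head r rs s))
    (cong (increasing r ∧_) (columnsIncreasing-ᵗ rs (IsShape-tail s)))

isSYT-ᵗ : ∀ k T → IsShape (shape T) → isSYT k (T ᵗ) ≡ isSYT k T
isSYT-ᵗ k T s = begin
  bijective k (T ᵗ) ∧ rowsIncreasing (T ᵗ) ∧ columnsIncreasing (T ᵗ)
    ≡⟨ cong₂ _∧_ (bijective-ᵗ k T) (cong₂ _∧_ (rowsIncreasing-ᵗ T s) (columnsIncreasing-ᵗ T s)) ⟩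
  bijective k T ∧ columnsIncreasing T ∧ rowsIncreasing T
    ≡⟨ cong (bijective k T ∧_) (∧-comm (columnsIncreasing T) (rowsIncreasing T)) ⟩
  bijective k T ∧ rowsIncreasing T ∧ columnsIncreasing T ∎
  where open ≡-Reasoning

-- Rows of the transpose are columns

position : ℕ → List ℕ → ℕ
position m [] = 0
position m (x ∷ xs) with m ≟ x
... | yes _ = 1
... | no _ = suc (position m xs)

column : List (List ℕ) → ℕ → ℕ
column [] m = 0
column (r ∷ rs) m = if occ m r ≡ᵇ 0 then column rs m else position m r

≡0⊎≡suc : ∀ n → n ≡ 0 ⊎ Σ ℕ λ j → n ≡ suc j
≡0⊎≡suc zero = inj₁ refl
≡0⊎≡suc (suc n) = inj₂ (n , refl)

R-skip : ∀ r rs m → occ m r ≡ 0 → R (r ∷ rs) m ≡ suc (R rs m)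
R-skip r rs m occ≡0 rewrite occ≡0 = refl

R-here : ∀ r rs m j → occ m r ≡ suc j → R (r ∷ rs) m ≡ 1
R-here r rs m j occ≡suc rewrite occ≡suc = refl

column-skip : ∀ r rs m → occ m r ≡ 0 → column (r ∷ rs) m ≡ column rs m
column-skip r rs m occ≡0 rewrite occ≡0 = refl

column-here : ∀ r rs m j → occ m r ≡ suc j → column (r ∷ rs) m ≡ position m r
column-here r rs m j occ≡suc rewrite occ≡suc = refl

occ-concat-tail : ∀ m r rs → occ m r ≡ 0 → 0 < occ m (concat (r ∷ rs)) → 0 < occ m (concat rs)
occ-concat-tail m r rs occ≡0 = subst (0 <_) (trans (occ-++ m r (concat rs)) (cong (_+ occ m (concat rs)) occ≡0))

R-consColumn-absent : ∀ m r C → occ m r ≡ 0 → 0 < occ m (concat C) → R (consColumn r C) m ≡ R C m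
R-consColumn-absent m [] C _ _ = refl
R-consColumn-absent m (x ∷ xs) (c ∷ C) m∉r m∈C with m ≟ x
... | yes refl = ⊥-elim (1+n≢0 (trans (sym (occ-here m xs)) m∉r))
... | no m≢x with ≡0⊎≡suc (occ m c)
...   | inj₁ m∉c = begin
  R ((x ∷ c) ∷ consColumn xs C) m ≡⟨ R-skip (x ∷ c) (consColumn xs C) m (trans (occ-there m x c m≢x) m∉c) ⟩
  suc (R (consColumn xs C) m)     ≡⟨ cong suc (R-consColumn-absent m xs C (trans (sym (occ-there m x xs m≢x)) m∉r)
                                                 (occ-concat-tail m c C m∉c m∈C)) ⟩
  suc (R C m)                     ≡⟨ R-skip c C m m∉c ⟨
  R (c ∷ C) m                     ∎
  where open ≡-Reasoning
...   | inj₂ (j , m∈c) =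
  trans (R-here (x ∷ c) (consColumn xs C) m j (trans (occ-there m x c m≢x) m∈c)) (sym (R-here c C m j m∈c))

R-consColumn-present : ∀ m r C → 0 < occ m r → occ m (concat C) ≡ 0 → R (consColumn r C) m ≡ position m r
R-consColumn-present m (x ∷ xs) C m∈r m∉C with m ≟ x
R-consColumn-present m (x ∷ xs) [] _ _ | yes refl = R-here (m ∷ []) (consColumn xs []) m 0 (occ-here m [])
R-consColumn-present m (x ∷ xs) (c ∷ C) _ _ | yes refl = R-here (m ∷ c) (consColumn xs C) m (occ m c) (occ-here m c)
R-consColumn-present m (x ∷ xs) [] m∈r _ | no m≢x =
  trans (R-skip (x ∷ []) (consColumn xs []) m (occ-there m x [] m≢x))
    (cong suc (R-consColumn-present m xs [] (subst (0 <_) (occ-there m x xs m≢x) m∈r) refl))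
R-consColumn-present m (x ∷ xs) (c ∷ C) m∈r m∉c∷C | no m≢x =
  trans (R-skip (x ∷ c) (consColumn xs C) m (trans (occ-there m x c m≢x) (m+n≡0⇒m≡0 (occ m c) m∉c∷C′)))
    (cong suc (R-consColumn-present m xs C (subst (0 <_) (occ-there m x xs m≢x) m∈r) (m+n≡0⇒n≡0 (occ m c) m∉c∷C′)))
  where m∉c∷C′ = trans (sym (occ-++ m c (concat C))) m∉c∷C

R-ᵗ≡column : ∀ m T → occ m (concat T) ≡ 1 → R (T ᵗ) m ≡ column T m
R-ᵗ≡column m (r ∷ rs) once with ≡0⊎≡suc (occ m r)
... | inj₁ m∉r = begin
  R (consColumn r (rs ᵗ)) m ≡⟨ R-consColumn-absent m r (rs ᵗ) m∉r (subst (0 <_) (sym (trans (occ-ᵗ m rs) once′)) (s≤s z≤n)) ⟩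
  R (rs ᵗ) m                ≡⟨ R-ᵗ≡column m rs once′ ⟩
  column rs m               ≡⟨ column-skip r rs m m∉r ⟨
  column (r ∷ rs) m         ∎
  where
    open ≡-Reasoning
    once′ : occ m (concat rs) ≡ 1
    once′ = trans (sym (cong (_+ occ m (concat rs)) m∉r)) (trans (sym (occ-++ m r (concat rs))) once)
... | inj₂ (j , m∈r) = begin
  R (consColumn r (rs ᵗ)) m ≡⟨ R-consColumn-present m r (rs ᵗ) (subst (0 <_) (sym m∈r) (s≤s z≤n)) (trans (occ-ᵗ m rs) m∉rs) ⟩
  position m r              ≡⟨ column-here r rs m j m∈r ⟨
  column (r ∷ rs) m         ∎
  where
    open ≡-Reasoning
    m∉rs : occ m (concat rs) ≡ 0
    m∉rs = m+n≡0⇒n≡0 j (suc-injective (trans (sym (cong (_+ occ m (concat rs)) m∈r)) (trans (sym (occ-++ m r (concat rs))) once)))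

-- Consecutive entries: one step down or one step right

-- At xs i v: the i-th entry of xs is v, counting from 1 as positions and columns do.
data At : List ℕ → ℕ → ℕ → Set where
  here  : ∀ {x xs} → At (x ∷ xs) 1 x
  there : ∀ {x xs i v} → At xs i v → At (x ∷ xs) (suc i) v

position-At : ∀ m r → 0 < occ m r → At r (position m r) m
position-At m (x ∷ xs) m∈r with m ≟ x
... | yes refl = here
... | no m≢x = there (position-At m xs (subst (0 <_) (occ-there m x xs m≢x) m∈r))

At-functional : ∀ {xs i u v} → At xs i u → At xs i v → u ≡ v
At-functional here here = refl
At-functional (there p) (there q) = At-functional p q

increasing-tail : ∀ x xs → increasing (x ∷ xs) ≡ true → increasing xs ≡ true
increasing-tail x [] _ = refl
increasing-tail x (y ∷ ys) inc = proj₂ (∧-true⁻ {x <ᵇ y} inc)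

increasing-head-< : ∀ x xs {j v} → increasing (x ∷ xs) ≡ true → At xs j v → x < v
increasing-head-< x (y ∷ ys) inc here = <ᵇ≡true⇒< (proj₁ (∧-true⁻ {x <ᵇ y} inc))
increasing-head-< x (y ∷ ys) inc (there p) =
  <-trans (<ᵇ≡true⇒< (proj₁ (∧-true⁻ {x <ᵇ y} inc))) (increasing-head-< y ys (proj₂ (∧-true⁻ {x <ᵇ y} inc)) p)

increasing-At-< : ∀ {r i j u v} → increasing r ≡ true → At r i u → At r j v → i < j → u < v
increasing-At-< {x ∷ xs} inc here (there q) _ = increasing-head-< x xs inc q
increasing-At-< {x ∷ xs} inc (there p) (there q) (s≤s i<j) = increasing-At-< (increasing-tail x xs inc) p q i<j
increasing-At-< _ here here (s≤s ())
increasing-At-< _ (there _) here (s≤s ())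

increasing-At-<-reflect : ∀ {r i j u v} → increasing r ≡ true → At r i u → At r j v → u < v → i < j
increasing-At-<-reflect {i = i} {j} inc p q u<v with <-cmp i j
... | tri< i<j _ _ = i<j
... | tri≈ _ refl _ = ⊥-elim (<-irrefl (At-functional p q) u<v)
... | tri> _ _ j<i = ⊥-elim (<-asym u<v (increasing-At-< inc q p j<i))

increasing-At-≤-reflect : ∀ {r i j u v} → increasing r ≡ true → At r i u → At r j v → u ≤ v → i ≤ j
increasing-At-≤-reflect inc p q u≤v = ≮⇒≥ (λ j<i → <⇒≱ (increasing-At-< inc q p j<i) u≤v)

columnsBelow-At : ∀ r r′ {j w} → columnsBelow r r′ ≡ true → At r′ j w → length r′ ≤ length r →
  Σ ℕ λ z → At r j z × z < w
columnsBelow-At (x ∷ xs) (y ∷ ys) below here _ = x , here , <ᵇ≡true⇒< (proj₁ (∧-true⁻ {x <ᵇ y} below))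
columnsBelow-At (x ∷ xs) (y ∷ ys) below (there p) (s≤s ys≤xs)
  with columnsBelow-At xs ys (proj₂ (∧-true⁻ {x <ᵇ y} below)) p ys≤xs
... | z , z-At , z<w = z , there z-At , z<w

columnsIncreasing-tail : ∀ r rs → columnsIncreasing (r ∷ rs) ≡ true → columnsIncreasing rs ≡ true
columnsIncreasing-tail r [] _ = refl
columnsIncreasing-tail r (r′ ∷ rs) cols = proj₂ (∧-true⁻ {columnsBelow r r′} cols)

column-At : ∀ r rs y → IsShape (shape (r ∷ rs)) → columnsIncreasing (r ∷ rs) ≡ true → 0 < occ y (concat rs) →
  Σ ℕ λ z → At r (column rs y) z × z < y
column-At r (r′ ∷ rs) y (cons _ (r′≤r ∷ _) s) cols y∈rs with ∧-true⁻ {columnsBelow r r′} cols | ≡0⊎≡suc (occ y r′)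
... | below , cols′ | inj₁ y∉r′ with column-At r′ rs y s cols′ (occ-concat-tail y r′ rs y∉r′ y∈rs)
...   | z′ , z′-At , z′<y with columnsBelow-At r r′ below z′-At r′≤r
...     | z , z-At , z<z′ = z , subst (λ i → At r i z) (sym (column-skip r′ rs y y∉r′)) z-At , <-trans z<z′ z′<y
column-At r (r′ ∷ rs) y (cons _ (r′≤r ∷ _) s) cols y∈rs | below , _ | inj₂ (j , y∈r′)
  with columnsBelow-At r r′ below (position-At y r′ (subst (0 <_) (sym y∈r′) (s≤s z≤n))) r′≤r
... | z , z-At , z<y = z , subst (λ i → At r i z) (sym (column-here r′ rs y j y∈r′)) z-At , z<y

suc≡⇒0< : ∀ {n j} → n ≡ suc j → 0 < n
suc≡⇒0< refl = s≤s z≤n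

R-positive : ∀ rs m → 0 < occ m (concat rs) → 0 < R rs m
R-positive (r ∷ rs) m _ with ≡0⊎≡suc (occ m r)
... | inj₁ m∉r = subst (0 <_) (sym (R-skip r rs m m∉r)) (s≤s z≤n)
... | inj₂ (j , m∈r) = subst (0 <_) (sym (R-here r rs m j m∈r)) (s≤s z≤n)

-- If a is in the top row and a + 1 below it, the entry above a + 1 is at most a,
-- so it sits weakly left of a; if a + 1 is in the top row and a below it, the
-- entry above a is smaller than a + 1, so it sits strictly left of a + 1.
R-<ᵇ≡not-column-<ᵇ : ∀ T a → IsShape (shape T) → rowsIncreasing T ≡ true → columnsIncreasing T ≡ true →
  0 < occ a (concat T) → 0 < occ (suc a) (concat T) →
  (R T a <ᵇ R T (suc a)) ≡ not (column T a <ᵇ column T (suc a))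
R-<ᵇ≡not-column-<ᵇ (r ∷ rs) a s rows cols a∈T a+1∈T
  with ≡0⊎≡suc (occ a r) | ≡0⊎≡suc (occ (suc a) r) | ∧-true⁻ {increasing r} rows
... | inj₂ (i , a∈r) | inj₂ (j , a+1∈r) | inc , _ = begin
  R (r ∷ rs) a <ᵇ R (r ∷ rs) (suc a)
    ≡⟨ cong₂ _<ᵇ_ (R-here r rs a i a∈r) (R-here r rs (suc a) j a+1∈r) ⟩
  false
    ≡⟨ cong not (<⇒<ᵇ≡true (increasing-At-<-reflect inc (position-At a r (suc≡⇒0< a∈r))
                                                         (position-At (suc a) r (suc≡⇒0< a+1∈r)) (n<1+n a))) ⟨
  not (position a r <ᵇ position (suc a) r)
    ≡⟨ cong not (cong₂ _<ᵇ_ (column-here r rs a i a∈r) (column-here r rs (suc a) j a+1∈r)) ⟨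
  not (column (r ∷ rs) a <ᵇ column (r ∷ rs) (suc a)) ∎
  where open ≡-Reasoning
... | inj₂ (i , a∈r) | inj₁ a+1∉r | inc , _ = begin
  R (r ∷ rs) a <ᵇ R (r ∷ rs) (suc a)
    ≡⟨ cong₂ _<ᵇ_ (R-here r rs a i a∈r) (R-skip r rs (suc a) a+1∉r) ⟩
  1 <ᵇ suc (R rs (suc a))
    ≡⟨ <⇒<ᵇ≡true (s≤s (R-positive rs (suc a) a+1∈rs)) ⟩
  true
    ≡⟨ cong not (≥⇒<ᵇ≡false above-a+1≤a) ⟨
  not (position a r <ᵇ column rs (suc a))
    ≡⟨ cong not (cong₂ _<ᵇ_ (column-here r rs a i a∈r) (column-skip r rs (suc a) a+1∉r)) ⟨
  not (column (r ∷ rs) a <ᵇ column (r ∷ rs) (suc a)) ∎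
  where
    open ≡-Reasoning
    a+1∈rs = occ-concat-tail (suc a) r rs a+1∉r a+1∈T
    above-a+1≤a : column rs (suc a) ≤ position a r
    above-a+1≤a with column-At r rs (suc a) s cols a+1∈rs
    ... | z , z-At , z<a+1 = increasing-At-≤-reflect inc z-At (position-At a r (suc≡⇒0< a∈r)) (m<1+n⇒m≤n z<a+1)
... | inj₁ a∉r | inj₂ (j , a+1∈r) | inc , _ = begin
  R (r ∷ rs) a <ᵇ R (r ∷ rs) (suc a)
    ≡⟨ cong₂ _<ᵇ_ (R-skip r rs a a∉r) (R-here r rs (suc a) j a+1∈r) ⟩
  suc (R rs a) <ᵇ 1
    ≡⟨ ≥⇒<ᵇ≡false {suc (R rs a)} (s≤s z≤n) ⟩
  false
    ≡⟨ cong not (<⇒<ᵇ≡true above-a<a+1) ⟨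
  not (column rs a <ᵇ position (suc a) r)
    ≡⟨ cong not (cong₂ _<ᵇ_ (column-skip r rs a a∉r) (column-here r rs (suc a) j a+1∈r)) ⟨
  not (column (r ∷ rs) a <ᵇ column (r ∷ rs) (suc a)) ∎
  where
    open ≡-Reasoning
    above-a<a+1 : column rs a < position (suc a) r
    above-a<a+1 with column-At r rs a s cols (occ-concat-tail a r rs a∉r a∈T)
    ... | z , z-At , z<a =
      increasing-At-<-reflect inc z-At (position-At (suc a) r (suc≡⇒0< a+1∈r)) (<-trans z<a (n<1+n a))
... | inj₁ a∉r | inj₁ a+1∉r | _ , rows′ = begin
  R (r ∷ rs) a <ᵇ R (r ∷ rs) (suc a)
    ≡⟨ cong₂ _<ᵇ_ (R-skip r rs a a∉r) (R-skip r rs (suc a) a+1∉r) ⟩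
  R rs a <ᵇ R rs (suc a)
    ≡⟨ R-<ᵇ≡not-column-<ᵇ rs a (IsShape-tail s) rows′ (columnsIncreasing-tail r rs cols)
         (occ-concat-tail a r rs a∉r a∈T) (occ-concat-tail (suc a) r rs a+1∉r a+1∈T) ⟩
  not (column rs a <ᵇ column rs (suc a))
    ≡⟨ cong not (cong₂ _<ᵇ_ (column-skip r rs a a∉r) (column-skip r rs (suc a) a+1∉r)) ⟨
  not (column (r ∷ rs) a <ᵇ column (r ∷ rs) (suc a)) ∎
  where open ≡-Reasoning

-- Transposing standard Young tableaux

∈-SYT⁻ : ∀ k μ {T} → T ∈ SYT k μ → T ∈ fillings k μ × isSYT k T ≡ true
∈-SYT⁻ k μ = ∈-filter⁻ (λ T → Data.Bool._≟_ (isSYT k T) true) {xs = fillings k μ}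

∈-SYT⁺ : ∀ k μ {T} → T ∈ fillings k μ → isSYT k T ≡ true → T ∈ SYT k μ
∈-SYT⁺ k μ = ∈-filter⁺ (λ T → Data.Bool._≟_ (isSYT k T) true) {xs = fillings k μ}

IsShape-∈-SYT : ∀ k {μ T} → IsShape μ → T ∈ SYT k μ → IsShape (shape T)
IsShape-∈-SYT k {μ} s T∈ = subst IsShape (sym (proj₁ (∈-fillings⁻ k μ (proj₁ (∈-SYT⁻ k μ T∈))))) s

ᵗ-∈-SYT : ∀ k {μ T} → IsShape μ → T ∈ SYT k μ → T ᵗ ∈ SYT k (transpose μ)
ᵗ-∈-SYT k {μ} {T} s T∈ with ∈-SYT⁻ k μ T∈
... | T∈fillings , T-SYT with ∈-fillings⁻ k μ T∈fillings
...   | shape-T , T-values =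
  ∈-SYT⁺ k (transpose μ)
    (∈-fillings⁺ k (transpose μ) (trans (shape-ᵗ T sT) (cong transpose shape-T)) (All-ᵗ T T-values))
    (trans (isSYT-ᵗ k T sT) T-SYT)
  where sT = IsShape-∈-SYT k s T∈

ᵗ-injective-on-SYT : ∀ k {μ T U} → IsShape μ → T ∈ SYT k μ → U ∈ SYT k μ → T ᵗ ≡ U ᵗ → T ≡ U
ᵗ-injective-on-SYT k {T = T} {U} s T∈ U∈ Tᵗ≡Uᵗ = begin
  T     ≡⟨ ᵗ-involutive T (IsShape-∈-SYT k s T∈) ⟨
  T ᵗ ᵗ ≡⟨ cong _ᵗ Tᵗ≡Uᵗ ⟩
  U ᵗ ᵗ ≡⟨ ᵗ-involutive U (IsShape-∈-SYT k s U∈) ⟩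
  U     ∎
  where open ≡-Reasoning

-- condHα 2 α checks the single index i = 1, i.e. the entries α + 1 and α + 2.
condHα-ᵗ : ∀ k α {μ T} → IsShape μ → 2 + α ≤ k → T ∈ SYT k μ → condHα 2 α (T ᵗ) ≡ not (condHα 2 α T)
condHα-ᵗ k α {μ} {T} s 2+α≤k T∈ with ∈-SYT⁻ k μ T∈
... | _ , T-SYT with ∧-true⁻ {bijective k T} T-SYT
...   | T-bijective , T-increasing with ∧-true⁻ {rowsIncreasing T} T-increasing
...     | rows , cols = begin
  (R (T ᵗ) a <ᵇ R (T ᵗ) (suc a)) ∧ true     ≡⟨ ∧-identityʳ _ ⟩
  R (T ᵗ) a <ᵇ R (T ᵗ) (suc a)              ≡⟨ cong₂ _<ᵇ_ (R-ᵗ≡column a T (once a∈values)) (R-ᵗ≡column (suc a) T (once a+1∈values)) ⟩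
  column T a <ᵇ column T (suc a)            ≡⟨ not-involutive _ ⟨
  not (not (column T a <ᵇ column T (suc a))) ≡⟨ cong not (R-<ᵇ≡not-column-<ᵇ T a (IsShape-∈-SYT k s T∈) rows cols
                                                            (suc≡⇒0< (once a∈values)) (suc≡⇒0< (once a+1∈values))) ⟨
  not (R T a <ᵇ R T (suc a))                ≡⟨ cong not (∧-identityʳ _) ⟨
  not ((R T a <ᵇ R T (suc a)) ∧ true)       ∎
  where
    open ≡-Reasoning
    a = suc α
    once : ∀ {m} → m ∈ values k → occ m (concat T) ≡ 1
    once {m} m∈ = ≡ᵇ⇒≡ (occ m (concat T)) 1
      (Equivalence.from T-≡ (allB-∈ (λ m → occ m (concat T) ≡ᵇ 1) T-bijective m∈))
    a∈values = ∈-map⁺ suc (∈-upTo⁺ (<-trans (n<1+n α) 2+α≤k))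
    a+1∈values = ∈-map⁺ suc (∈-upTo⁺ 2+α≤k)

-- fHα 2 α k μ is definitionally length (SYT-where α k μ true).
SYT-where : ℕ → ℕ → List ℕ → Bool → List (List (List ℕ))
SYT-where α k μ b = filter (λ T → Data.Bool._≟_ (condHα 2 α T) b) (SYT k μ)

length-SYT-where-≤-transpose : ∀ k α {μ} → IsShape μ → 2 + α ≤ k → ∀ b →
  length (SYT-where α k μ b) ≤ length (SYT-where α k (transpose μ) (not b))
length-SYT-where-≤-transpose k α {μ} s 2+α≤k b =
  length-≤-by-injection (≡-dec (≡-dec _≟_)) _ᵗ (SYT-where α k μ b) (SYT-where α k (transpose μ) (not b))
    (Unique.filter⁺ condition? (Unique.filter⁺ syt? (fillings-Unique k μ)))
    (λ T∈ → let T∈SYT , cond-T = ∈-filter⁻ condition? {xs = SYT k μ} T∈ in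
      ∈-filter⁺ (λ T → Data.Bool._≟_ (condHα 2 α T) (not b)) (ᵗ-∈-SYT k s T∈SYT)
        (trans (condHα-ᵗ k α s 2+α≤k T∈SYT) (cong not cond-T)))
    (λ T∈ U∈ → ᵗ-injective-on-SYT k s (proj₁ (∈-filter⁻ condition? {xs = SYT k μ} T∈))
                                       (proj₁ (∈-filter⁻ condition? {xs = SYT k μ} U∈)))
  where
    syt? = λ T → Data.Bool._≟_ (isSYT k T) true
    condition? = λ T → Data.Bool._≟_ (condHα 2 α T) b

proposition3p3 : (k : ℕ) → 2 ≤ k → (λs : List ℕ) → IsPartitionOf λs k →
    (α : ℕ) → α ≤ k ∸ 2 →
    fHα 2 α k λs + fHα 2 α k (transpose λs) ≡ f k λs
proposition3p3 k (s≤s (s≤s _)) λs λ⊢k α α≤k-2 = begin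
  fHα 2 α k λs + fHα 2 α k (transpose λs)     ≡⟨ cong (fHα 2 α k λs +_) transposed-count ⟩
  fHα 2 α k λs + length (SYT-where α k λs false) ≡⟨ length-filter-true+false (condHα 2 α) (SYT k λs) ⟩
  f k λs                                     ∎
  where
    open ≡-Reasoning
    s = IsPartitionOf⇒IsShape λ⊢k
    2+α≤k = s≤s (s≤s α≤k-2)
    transposed-count : fHα 2 α k (transpose λs) ≡ length (SYT-where α k λs false)
    transposed-count = ≤-antisym
      (subst (λ μ → fHα 2 α k (transpose λs) ≤ length (SYT-where α k μ false)) (transpose-involutive s)
        (length-SYT-where-≤-transpose k α (IsShape-transpose s) 2+α≤k true))
      (length-SYT-where-≤-transpose k α s 2+α≤k false)
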